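{- If the sequent $\Gamma\longrightarrow\Delta$ (with $\Gamma,\Delta$ finite multisets of arbitrary formulas) has a C-proof with nonconstructiveness measure $0$, then there is some formula $F\in\Delta$ such that $\Gamma\longrightarrow F$ has an I-proof.
   Context: Formulas are first-order with logical symbols $\top,\bot,\land,\lor,\supset,\exists,\forall$; $\top,\bot$ are not atomic. A sequent $\Gamma\longrightarrow\Delta$ is a pair of finite multisets of formulas. A C-proof is a derivation in the classical multiple-succedent sequent calculus whose axioms are sequents with $\top\in\Delta$ or with some $A$ ($\bot$ or atomic) in both $\Gamma$ and $\Delta$, and whose rules are: contr-L ($B,B,\Gamma\longrightarrow\Delta\Rightarrow B,\Gamma\longrightarrow\Delta$), contr-R ($\Gamma\longrightarrow\Delta,B,B\Rightarrow\Gamma\longrightarrow\Delta,B$), $\bot$-R ($\Gamma\longrightarrow\Delta,\bot\Rightarrow\Gamma\longrightarrow\Delta,D$), $\land$-L ($B,D,B\land D,\Gamma\longrightarrow\Delta\Rightarrow B\land D,\Gamma\longrightarrow\Delta$), $\land$-R ($\Gamma\longrightarrow\Delta,B$ and $\Gamma\longrightarrow\Delta,D\Rightarrow\Gamma\longrightarrow\Delta,B\land D$), $\lor$-L ($B,\Gamma\longrightarrow\Delta$ and $D,\Gamma\longrightarrow\Delta\Rightarrow B\lor D,\Gamma\longrightarrow\Delta$), $\lor$-R ($\Gamma\longrightarrow\Delta,B$ or $\Gamma\longrightarrow\Delta,D\Rightarrow\Gamma\longrightarrow\Delta,B\lor D$), $\supset$-L ($B\supset D,\Gamma\longrightarrow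 B,\Delta$ and $D,\Gamma\longrightarrow\Theta\Rightarrow B\supset D,\Gamma\longrightarrow\Delta,\Theta$), $\supset$-R ($B,\Gamma\longrightarrow\Delta,D\Rightarrow\Gamma\longrightarrow\Delta,B\supset D$), $\forall$-L ($[t/x]B,\forall xB,\Gamma\longrightarrow\Delta\Rightarrow\forall xB,\Gamma\longrightarrow\Delta$), $\exists$-R ($\Gamma\longrightarrow\Delta,[t/x]B\Rightarrow\Gamma\longrightarrow\Delta,\exists xB$), $\exists$-L ($[c/x]B,\Gamma\longrightarrow\Delta\Rightarrow\exists xB,\Gamma\longrightarrow\Delta$), $\forall$-R ($\Gamma\longrightarrow\Delta,[c/x]B\Rightarrow\Gamma\longrightarrow\Delta,\forall xB$), $c$ a constant not in the lower sequent. An I-proof is a C-proof in which every sequent has exactly one succedent formula. In a C-proof $\Xi$, an occurrence of $\lor$-L with lower sequent $B\lor D,\Gamma\longrightarrow\Delta$ is nonconstructive if there is no $F\in\Delta$ such that both $B,\Gamma\longrightarrow F$ and $D,\Gamma\longrightarrow F$ have I-proofs; an occurrence of $\supset$-R with upper sequent $B,\Gamma\longrightarrow\Delta,D$ and lower sequent $\Gamma\longrightarrow\Delta,B\supset D$ is nonconstructive if $B,\Gamma\longrightarrow D$ has no I-proof. The nonconstructiveness measure $\mu(\Xi)$ is the number of nonconstructive occurrences of $\lor$-L and $\supset$-R rules in $\Xi$. -}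

module Defs where

open import Data.Nat using (ℕ; _≡ᵇ_)
open import Data.Bool using (Bool; true; false; if_then_else_)
open import Data.List using (List; []; _∷_; _++_; length)
open import Data.List.Membership.Propositional using (_∈_)
open import Data.List.Relation.Binary.Permutation.Propositional using (_↭_)
open import Data.Product using (Σ; ∃-syntax; _×_)
open import Data.Empty using (⊥)
open import Data.Unit using () renaming (⊤ to Unit)
open import Relation.Binary.PropositionalEquality using (_≡_; _≢_)

-- First-order terms and formulas (named variables; constants are
-- function symbols applied to no arguments).

data Term : Set where
  var : ℕ → Term
  app : ℕ → List Term → Term

data GTerm : Set where
  gapp : ℕ → List GTerm → GTerm

cst : ℕ → GTerm
cst c = gapp c []

mutual
  embed : GTerm → Term
  embed (gapp f ts) = app f (embedL ts)

  embedL : List GTerm → List Term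
  embedL []       = []
  embedL (t ∷ ts) = embed t ∷ embedL ts

infixr 6 _∧'_
infixr 5 _∨'_
infixr 4 _⊃_

data Formula : Set where
  atom : ℕ → List Term → Formula
  ⊤'   : Formula
  ⊥'   : Formula
  _∧'_ : Formula → Formula → Formula
  _∨'_ : Formula → Formula → Formula
  _⊃_  : Formula → Formula → Formula
  ∃'   : ℕ → Formula → Formula
  ∀'   : ℕ → Formula → Formula

-- Substitution [t/x] of a ground term t for the variable x
-- (no capture can occur since t is closed).
mutual
  substT : GTerm → ℕ → Term → Term
  substT t x (var y)    = if x ≡ᵇ y then embed t else var y
  substT t x (app f us) = app f (substL t x us)

  substL : GTerm → ℕ → List Term → List Term
  substL t x []       = []
  substL t x (u ∷ us) = substT t x u ∷ substL t x us

[_/_]_ : GTerm → ℕ → Formula → Formula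
[ t / x ] atom p us = atom p (substL t x us)
[ t / x ] ⊤'        = ⊤'
[ t / x ] ⊥'        = ⊥'
[ t / x ] (B ∧' D)  = [ t / x ] B ∧' [ t / x ] D
[ t / x ] (B ∨' D)  = [ t / x ] B ∨' [ t / x ] D
[ t / x ] (B ⊃ D)   = [ t / x ] B ⊃ [ t / x ] D
[ t / x ] ∃' y B    = if x ≡ᵇ y then ∃' y B else ∃' y ([ t / x ] B)
[ t / x ] ∀' y B    = if x ≡ᵇ y then ∀' y B else ∀' y ([ t / x ] B)

data AtomOrBot : Formula → Set where
  isAtom : ∀ p us → AtomOrBot (atom p us)
  isBot  : AtomOrBot ⊥'

mutual
  FreshT : ℕ → Term → Set
  FreshT c (var _)    = Unit
  FreshT c (app f us) = (c ≢ f) × FreshL c us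

  FreshL : ℕ → List Term → Set
  FreshL c []       = Unit
  FreshL c (u ∷ us) = FreshT c u × FreshL c us

FreshF : ℕ → Formula → Set
FreshF c (atom p us) = FreshL c us
FreshF c ⊤'          = Unit
FreshF c ⊥'          = Unit
FreshF c (B ∧' D)    = FreshF c B × FreshF c D
FreshF c (B ∨' D)    = FreshF c B × FreshF c D
FreshF c (B ⊃ D)     = FreshF c B × FreshF c D
FreshF c (∃' _ B)    = FreshF c B
FreshF c (∀' _ B)    = FreshF c B

FreshCtx : ℕ → List Formula → Set
FreshCtx c []       = Unit
FreshCtx c (B ∷ Γ)  = FreshF c B × FreshCtx c Γ

FreshSeq : ℕ → List Formula → List Formula → Set
FreshSeq c Γ Δ = FreshCtx c Γ × FreshCtx c Δ

-- C-proofs.  Sequents are pairs of finite multisets, represented as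
-- lists up to permutation (rule `exch`).  The principal formula is
-- written at the head of the list.

infix 3 _⟶_

data _⟶_ : List Formula → List Formula → Set where
  ax⊤    : ∀ {Γ Δ} → ⊤' ∈ Δ → Γ ⟶ Δ
  axA    : ∀ {Γ Δ A} → AtomOrBot A → A ∈ Γ → A ∈ Δ → Γ ⟶ Δ
  exch   : ∀ {Γ Γ' Δ Δ'} → Γ ↭ Γ' → Δ ↭ Δ' → Γ ⟶ Δ → Γ' ⟶ Δ'
  contrL : ∀ {Γ Δ B} → B ∷ B ∷ Γ ⟶ Δ → B ∷ Γ ⟶ Δ
  contrR : ∀ {Γ Δ B} → Γ ⟶ B ∷ B ∷ Δ → Γ ⟶ B ∷ Δ
  ⊥R     : ∀ {Γ Δ D} → Γ ⟶ ⊥' ∷ Δ → Γ ⟶ D ∷ Δ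
  ∧L     : ∀ {Γ Δ B D} → B ∷ D ∷ (B ∧' D) ∷ Γ ⟶ Δ → (B ∧' D) ∷ Γ ⟶ Δ
  ∧R     : ∀ {Γ Δ B D} → Γ ⟶ B ∷ Δ → Γ ⟶ D ∷ Δ → Γ ⟶ (B ∧' D) ∷ Δ
  ∨L     : ∀ {Γ Δ B D} → B ∷ Γ ⟶ Δ → D ∷ Γ ⟶ Δ → (B ∨' D) ∷ Γ ⟶ Δ
  ∨R₁    : ∀ {Γ Δ B D} → Γ ⟶ B ∷ Δ → Γ ⟶ (B ∨' D) ∷ Δ
  ∨R₂    : ∀ {Γ Δ B D} → Γ ⟶ D ∷ Δ → Γ ⟶ (B ∨' D) ∷ Δ
  ⊃L     : ∀ {Γ Δ Θ B D} → (B ⊃ D) ∷ Γ ⟶ B ∷ Δ → D ∷ Γ ⟶ Θ →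
           (B ⊃ D) ∷ Γ ⟶ Δ ++ Θ
  ⊃R     : ∀ {Γ Δ B D} → B ∷ Γ ⟶ D ∷ Δ → Γ ⟶ (B ⊃ D) ∷ Δ
  ∀L     : ∀ {Γ Δ x B} (t : GTerm) →
           ([ t / x ] B) ∷ ∀' x B ∷ Γ ⟶ Δ → ∀' x B ∷ Γ ⟶ Δ
  ∃R     : ∀ {Γ Δ x B} (t : GTerm) →
           Γ ⟶ ([ t / x ] B) ∷ Δ → Γ ⟶ ∃' x B ∷ Δ
  ∃L     : ∀ {Γ Δ x B} (c : ℕ) → FreshSeq c (∃' x B ∷ Γ) Δ →
           ([ cst c / x ] B) ∷ Γ ⟶ Δ → ∃' x B ∷ Γ ⟶ Δ
  ∀R     : ∀ {Γ Δ x B} (c : ℕ) → FreshSeq c Γ (∀' x B ∷ Δ) →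
           Γ ⟶ ([ cst c / x ] B) ∷ Δ → Γ ⟶ ∀' x B ∷ Δ

SingleSucc : ∀ {Γ Δ} → Γ ⟶ Δ → Set
SingleSucc {Δ = Δ} p = (length Δ ≡ 1) × go p
  where
  go : ∀ {Γ Δ} → Γ ⟶ Δ → Set
  go (ax⊤ _)        = Unit
  go (axA _ _ _)    = Unit
  go (exch _ _ q)   = SingleSucc q
  go (contrL q)     = SingleSucc q
  go (contrR q)     = SingleSucc q
  go (⊥R q)         = SingleSucc q
  go (∧L q)         = SingleSucc q
  go (∧R q r)       = SingleSucc q × SingleSucc r
  go (∨L q r)       = SingleSucc q × SingleSucc r
  go (∨R₁ q)        = SingleSucc q
  go (∨R₂ q)        = SingleSucc q
  go (⊃L q r)       = SingleSucc q × SingleSucc r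
  go (⊃R q)         = SingleSucc q
  go (∀L _ q)       = SingleSucc q
  go (∃R _ q)       = SingleSucc q
  go (∃L _ _ q)     = SingleSucc q
  go (∀R _ _ q)     = SingleSucc q

IProvable : List Formula → Formula → Set
IProvable Γ F = Σ (Γ ⟶ F ∷ []) SingleSucc

-- Nonconstructiveness measure μ(Ξ) = 0: every occurrence of ∨-L and
-- ⊃-R in Ξ is constructive (i.e. not nonconstructive).

Mu0 : ∀ {Γ Δ} → Γ ⟶ Δ → Set
Mu0 (ax⊤ _)        = Unit
Mu0 (axA _ _ _)    = Unit
Mu0 (exch _ _ q)   = Mu0 q
Mu0 (contrL q)     = Mu0 q
Mu0 (contrR q)     = Mu0 q
Mu0 (⊥R q)         = Mu0 q
Mu0 (∧L q)         = Mu0 q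
Mu0 (∧R q r)       = Mu0 q × Mu0 r
Mu0 (∨L {Γ} {Δ} {B} {D} q r) =
  (∃[ F ] (F ∈ Δ × IProvable (B ∷ Γ) F × IProvable (D ∷ Γ) F))
  × Mu0 q × Mu0 r
Mu0 (∨R₁ q)        = Mu0 q
Mu0 (∨R₂ q)        = Mu0 q
Mu0 (⊃L q r)       = Mu0 q × Mu0 r
Mu0 (⊃R {Γ} {Δ} {B} {D} q) = IProvable (B ∷ Γ) D × Mu0 q
Mu0 (∀L _ q)       = Mu0 q
Mu0 (∃R _ q)       = Mu0 q
Mu0 (∃L _ _ q)     = Mu0 q
Mu0 (∀R _ _ q)     = Mu0 q

{-# OPTIONS --safe #-}
-- Induction on the C-proof, carrying an I-provable succedent formula down the
-- derivation.  Every rule except ∨-L and ⊃-R has a single-succedent instance,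
-- and a rule whose principal formula is not the carried one leaves it alone;
-- in ⊃-L, if the left premise only yields its principal formula B, the right
-- premise supplies the witness.  For ∨-L and ⊃-R the witness is exactly what
-- constructiveness (μ = 0) provides.
module Submission where

open import Defs
open import Data.Nat using (ℕ)
open import Level using (Level)
open import Data.List using (List; []; _∷_)
open import Data.List.Membership.Propositional using (_∈_; find; lose)
open import Data.List.Relation.Unary.Any as Any using (Any; here; there)
open import Data.List.Relation.Unary.Any.Properties using (++⁺ˡ; ++⁺ʳ)
open import Data.List.Relation.Binary.Permutation.Propositional using (_↭_; ↭-refl)
open import Data.List.Relation.Binary.Permutation.Propositional.Properties using (Any-resp-↭)
open import Data.Product using (∃-syntax; _×_; _,_)
open import Data.Unit using (tt)
open import Relation.Binary.PropositionalEquality using (refl)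
open import Relation.Unary using (Pred)

private variable
  ℓ : Level
  A : Set ℓ
  P Q : Pred A ℓ
  x y : A
  xs : List A
  Γ Γ' Δ : List Formula
  B D F : Formula
  c n : ℕ

Any-mapʰ : (P x → P y) → Any P (x ∷ xs) → Any P (y ∷ xs)
Any-mapʰ f (here px) = here (f px)
Any-mapʰ f (there pxs) = there pxs

Any-contractʰ : Any P (x ∷ x ∷ xs) → Any P (x ∷ xs)
Any-contractʰ (here px) = here px
Any-contractʰ (there pxs) = pxs

FreshCtx-Any-map : (∀ {F} → FreshF c F → P F → Q F) →
                   FreshCtx c Δ → Any P Δ → Any Q Δ
FreshCtx-Any-map f (cF , _) (here pF) = here (f cF pF)
FreshCtx-Any-map f (_ , cΔ) (there pΔ) = there (FreshCtx-Any-map f cΔ pΔ)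

module IRules where

  ax⊤ᴵ : IProvable Γ ⊤'
  ax⊤ᴵ = ax⊤ (here refl) , refl , tt

  axAᴵ : AtomOrBot F → F ∈ Γ → IProvable Γ F
  axAᴵ a F∈Γ = axA a F∈Γ (here refl) , refl , tt

  exchᴵ : Γ ↭ Γ' → IProvable Γ F → IProvable Γ' F
  exchᴵ π (p , s) = exch π ↭-refl p , refl , s

  contrLᴵ : IProvable (B ∷ B ∷ Γ) F → IProvable (B ∷ Γ) F
  contrLᴵ (p , s) = contrL p , refl , s

  ⊥Rᴵ : IProvable Γ ⊥' → IProvable Γ D
  ⊥Rᴵ (p , s) = ⊥R p , refl , s

  ∧Lᴵ : IProvable (B ∷ D ∷ (B ∧' D) ∷ Γ) F → IProvable ((B ∧' D) ∷ Γ) F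
  ∧Lᴵ (p , s) = ∧L p , refl , s

  ∧Rᴵ : IProvable Γ B → IProvable Γ D → IProvable Γ (B ∧' D)
  ∧Rᴵ (p , s) (p' , s') = ∧R p p' , refl , (s , s')

  ∨Lᴵ : IProvable (B ∷ Γ) F → IProvable (D ∷ Γ) F → IProvable ((B ∨' D) ∷ Γ) F
  ∨Lᴵ (p , s) (p' , s') = ∨L p p' , refl , (s , s')

  ∨R₁ᴵ : IProvable Γ B → IProvable Γ (B ∨' D)
  ∨R₁ᴵ (p , s) = ∨R₁ p , refl , s

  ∨R₂ᴵ : IProvable Γ D → IProvable Γ (B ∨' D)
  ∨R₂ᴵ (p , s) = ∨R₂ p , refl , s

  ⊃Lᴵ : IProvable ((B ⊃ D) ∷ Γ) B → IProvable (D ∷ Γ) F → IProvable ((B ⊃ D) ∷ Γ) F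
  ⊃Lᴵ (p , s) (p' , s') = ⊃L {Δ = []} p p' , refl , (s , s')

  ⊃Rᴵ : IProvable (B ∷ Γ) D → IProvable Γ (B ⊃ D)
  ⊃Rᴵ (p , s) = ⊃R p , refl , s

  ∀Lᴵ : (t : GTerm) → IProvable (([ t / n ] B) ∷ ∀' n B ∷ Γ) F → IProvable (∀' n B ∷ Γ) F
  ∀Lᴵ t (p , s) = ∀L t p , refl , s

  ∃Rᴵ : (t : GTerm) → IProvable Γ ([ t / n ] B) → IProvable Γ (∃' n B)
  ∃Rᴵ t (p , s) = ∃R t p , refl , s

  ∃Lᴵ : FreshCtx c (∃' n B ∷ Γ) → FreshF c F →
        IProvable (([ cst c / n ] B) ∷ Γ) F → IProvable (∃' n B ∷ Γ) F
  ∃Lᴵ cΓ cF (p , s) = ∃L _ (cΓ , cF , tt) p , refl , s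

  ∀Rᴵ : FreshCtx c Γ → FreshF c (∀' n B) →
        IProvable Γ ([ cst c / n ] B) → IProvable Γ (∀' n B)
  ∀Rᴵ cΓ cB (p , s) = ∀R _ (cΓ , cB , tt) p , refl , s

open IRules

Mu0⇒Any-IProvable : (Ξ : Γ ⟶ Δ) → Mu0 Ξ → Any (IProvable Γ) Δ
Mu0⇒Any-IProvable (ax⊤ ⊤∈Δ) _ = lose ⊤∈Δ ax⊤ᴵ
Mu0⇒Any-IProvable (axA a A∈Γ A∈Δ) _ = lose A∈Δ (axAᴵ a A∈Γ)
Mu0⇒Any-IProvable (exch π ρ Ξ) μ =
  Any-resp-↭ ρ (Any.map (exchᴵ π) (Mu0⇒Any-IProvable Ξ μ))
Mu0⇒Any-IProvable (contrL Ξ) μ = Any.map contrLᴵ (Mu0⇒Any-IProvable Ξ μ)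
Mu0⇒Any-IProvable (contrR Ξ) μ = Any-contractʰ (Mu0⇒Any-IProvable Ξ μ)
Mu0⇒Any-IProvable (⊥R Ξ) μ = Any-mapʰ ⊥Rᴵ (Mu0⇒Any-IProvable Ξ μ)
Mu0⇒Any-IProvable (∧L Ξ) μ = Any.map ∧Lᴵ (Mu0⇒Any-IProvable Ξ μ)
Mu0⇒Any-IProvable (∧R Ξ₁ Ξ₂) (μ₁ , μ₂)
  with Mu0⇒Any-IProvable Ξ₁ μ₁ | Mu0⇒Any-IProvable Ξ₂ μ₂
... | here p₁  | here p₂  = here (∧Rᴵ p₁ p₂)
... | there a₁ | _        = there a₁
... | here _   | there a₂ = there a₂
Mu0⇒Any-IProvable (∨L _ _) ((F , F∈Δ , p₁ , p₂) , _) = lose F∈Δ (∨Lᴵ p₁ p₂)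
Mu0⇒Any-IProvable (∨R₁ Ξ) μ = Any-mapʰ ∨R₁ᴵ (Mu0⇒Any-IProvable Ξ μ)
Mu0⇒Any-IProvable (∨R₂ Ξ) μ = Any-mapʰ ∨R₂ᴵ (Mu0⇒Any-IProvable Ξ μ)
Mu0⇒Any-IProvable (⊃L {Δ = Δ} Ξ₁ Ξ₂) (μ₁ , μ₂) with Mu0⇒Any-IProvable Ξ₁ μ₁
... | here p₁ = ++⁺ʳ Δ (Any.map (⊃Lᴵ p₁) (Mu0⇒Any-IProvable Ξ₂ μ₂))
... | there a₁ = ++⁺ˡ a₁
Mu0⇒Any-IProvable (⊃R _) (p , _) = here (⊃Rᴵ p)
Mu0⇒Any-IProvable (∀L t Ξ) μ = Any.map (∀Lᴵ t) (Mu0⇒Any-IProvable Ξ μ)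
Mu0⇒Any-IProvable (∃R t Ξ) μ = Any-mapʰ (∃Rᴵ t) (Mu0⇒Any-IProvable Ξ μ)
Mu0⇒Any-IProvable (∃L _ (cΓ , cΔ) Ξ) μ =
  FreshCtx-Any-map (∃Lᴵ cΓ) cΔ (Mu0⇒Any-IProvable Ξ μ)
Mu0⇒Any-IProvable (∀R _ (cΓ , cB , _) Ξ) μ =
  Any-mapʰ (∀Rᴵ cΓ cB) (Mu0⇒Any-IProvable Ξ μ)

lemma2 : ∀ {Γ Δ : List Formula} (Ξ : Γ ⟶ Δ) → Mu0 Ξ →
         ∃[ F ] (F ∈ Δ × IProvable Γ F)
lemma2 Ξ μ = find (Mu0⇒Any-IProvable Ξ μ)
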